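{- Let $D$ be any digraph, $\omega$ an end of $D$ and $v$ a vertex of $D$. Then $v$ dominates $\omega$ if and only if $v$ dominates $f_\omega$; and $v$ reverse dominates $\omega$ if and only if $v$ reverse dominates $f_\omega$.
   Context: Digraphs have no loops and no parallel edges, but may contain both $uv$ and $vu$. $\mathcal{X}(D)$ is the set of finite subsets of $V(D)$. A ray is a digraph on distinct vertices $v_0,v_1,\dots$ with edges $v_iv_{i+1}$; its tails are its subrays. A ray $R\subseteq D$ is solid if for every $X\in\mathcal{X}(D)$ some tail of $R$ lies in a single strong component of $D-X$. Two solid rays are equivalent if for every $X$ they have tails in the same strong component of $D-X$; equivalence classes are the ends. $C(X,\omega)$ is the strong component of $D-X$ containing a tail of every ray in $\omega$, and $f_\omega$ is the map $X\mapsto C(X,\omega)$ on $\mathcal{X}(D)$. A vertex-direction is a map $f$ on $\mathcal{X}(D)$ sending each $X$ to a strong component of $D-X$ with $f(X)\supseteq f(Y)$ whenever $X\subseteq Y$. A separation of $D$ is a pair $(A,B)$ with $A\cup B=V(D)$ and no edge from $B\setminus A$ to $A\setminus B$; finite order means $A\cap B$ finite; it points towards $f$ if $f(A\cap B)\subseteq B\setminus A$ and away from $f$ if $f(A\cap B)\subseteq A\setminus B$. An $a$–$B$ fan is a set of directed paths from $a$ to $B$ (each meeting $B$ only in its last vertex) any two of which meet only in $a$; an $a$–$B$ reverse fan is a set of directed paths from $B$ to $a$ (each meeting $B$ only in its first vertex) any two meeting only in $a$. A vertex $v$ dominates a ray $R$ if $D$ contains an infinite $v$–$V(R)$ fan,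 and reverse dominates $R$ if $D$ contains an infinite $v$–$V(R)$ reverse fan; $v$ (reverse) dominates an end $\omega$ if it (reverse) dominates some ray in $\omega$. A vertex $v$ dominates a vertex-direction $f$ if $v\in A$ for every finite order separation $(A,B)$ pointing away from $f$, and reverse dominates $f$ if $v\in B$ for every finite order separation $(A,B)$ pointing towards $f$. -}

module Defs where

open import Level using (Level; 0ℓ) renaming (suc to lsuc)
open import Data.Nat using (ℕ; zero; suc; _+_; _≤_; _<_)
open import Data.Product using (Σ; _×_; _,_; ∃; ∃-syntax)
open import Data.Sum using (_⊎_)
open import Data.List using (List)
open import Data.List.Membership.Propositional using (_∈_; _∉_)
open import Relation.Nullary using (¬_)
import Data.Empty
open import Relation.Binary.PropositionalEquality using (_≡_; _≢_)
open import Function.Bundles using (_⇔_)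
open import Axiom.ExcludedMiddle using (ExcludedMiddle)

-- Digraphs: a vertex type and an edge relation (so no parallel edges),
-- without loops.  Both uv and vu may be edges.

record Digraph : Set₁ where
  field
    V      : Set
    E      : V → V → Set
    E-prop : ∀ {u w} (e e′ : E u w) → e ≡ e′
    loopless : ∀ v → ¬ E v v

module _ (D : Digraph) where
  open Digraph D

  -- Finite vertex sets X ∈ 𝒳(D) are given by lists.
  Fin-set : Set
  Fin-set = List V

  data Reach (X : List V) : V → V → Set where
    here : ∀ {u} → u ∉ X → Reach X u u
    step : ∀ {u w x} → u ∉ X → E u w → Reach X w x → Reach X u x

  SameSC : List V → V → V → Set
  SameSC X u w = Reach X u w × Reach X w u

  IsStrongComponent : List V → (V → Set) → Set
  IsStrongComponent X C = Σ V λ u → u ∉ X × (∀ w → C w ⇔ SameSC X u w)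

  record Ray : Set where
    field
      vtx  : ℕ → V
      inj  : ∀ i j → vtx i ≡ vtx j → i ≡ j
      edge : ∀ i → E (vtx i) (vtx (suc i))
  open Ray public

  TailInOneSC : List V → Ray → Set
  TailInOneSC X R = Σ ℕ λ n → ∀ i j → n ≤ i → n ≤ j → SameSC X (vtx R i) (vtx R j)

  Solid : Ray → Set
  Solid R = ∀ (X : List V) → TailInOneSC X R

  Equivalent : Ray → Ray → Set
  Equivalent R S = ∀ (X : List V) → Σ ℕ λ n →
    ∀ i j → n ≤ i → n ≤ j → SameSC X (vtx R i) (vtx S j)

  -- An end is an equivalence class of solid rays; we represent an end
  -- by a solid representative ray.  A ray lies in the end represented by
  -- R iff it is solid and equivalent to R.
  record End : Set where
    field
      rep   : Ray
      solid : Solid rep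
  open End public

  InEnd : Ray → End → Set
  InEnd S ω = Solid S × Equivalent S (rep ω)

  -- C(X, ω): the strong component of D − X containing a tail of every
  -- ray in ω (equivalently, of the representative ray).
  C : List V → End → V → Set
  C X ω w = Σ ℕ λ n → ∀ i → n ≤ i → SameSC X w (vtx (rep ω) i)

  f[_] : End → List V → V → Set
  f[ ω ] X = C X ω

  -- A directed path of length n is given by n and p : ℕ → V
  -- (only p 0 … p n matter), with distinct vertices p 0 … p n.
  -- Forward orientation: edges p i → p (i+1), running from p 0 to p n.
  -- Backward orientation: edges p (i+1) → p i, running from p n to p 0.

  data Orientation : Set where
    forward backward : Orientation

  EdgeIn : Orientation → V → V → Set
  EdgeIn forward  x y = E x y
  EdgeIn backward x y = E y x

  record PathAB (o : Orientation) (a : V) (B : V → Set) : Set where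
    field
      len   : ℕ
      pt    : ℕ → V
      start : pt 0 ≡ a
      endB  : B (pt len)
      avoid : ∀ i → i < len → ¬ B (pt i)
      edges : ∀ i → i < len → EdgeIn o (pt i) (pt (suc i))
      dist  : ∀ i j → i ≤ len → j ≤ len → pt i ≡ pt j → i ≡ j
  open PathAB public

  -- An infinite a–B fan (o = forward) resp. reverse fan (o = backward):
  -- an ℕ-indexed family of pairwise distinct such paths, any two of which
  -- meet only in a.  (Distinct paths meeting only in a are exactly those
  -- with distinct last vertices in B, hence the condition `distinct`.)
  record InfiniteFan (o : Orientation) (a : V) (B : V → Set) : Set where
    field
      path     : ℕ → PathAB o a B
      meet     : ∀ j k → j ≢ k → ∀ i l → i ≤ len (path j) → l ≤ len (path k) →
                 pt (path j) i ≡ pt (path k) l → pt (path j) i ≡ a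
      distinct : ∀ j k → j ≢ k →
                 pt (path j) (len (path j)) ≢ pt (path k) (len (path k))

  OnRay : Ray → V → Set
  OnRay R w = Σ ℕ λ i → vtx R i ≡ w

  DominatesRay : V → Ray → Set
  DominatesRay v R = InfiniteFan forward v (OnRay R)

  RevDominatesRay : V → Ray → Set
  RevDominatesRay v R = InfiniteFan backward v (OnRay R)

  DominatesEnd : V → End → Set
  DominatesEnd v ω = Σ Ray λ S → InEnd S ω × DominatesRay v S

  RevDominatesEnd : V → End → Set
  RevDominatesEnd v ω = Σ Ray λ S → InEnd S ω × RevDominatesRay v S

  -- Separations of finite order.  A ∩ B is given by the finite list sep.

  record FinSeparation : Set₁ where
    field
      A B   : V → Set
      cover : ∀ v → A v ⊎ B v
      noBA  : ∀ u w → E u w → B u → ¬ A u → A w → ¬ B w → Data.Empty.⊥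
      sep   : List V
      sepOK : ∀ v → (A v × B v) ⇔ v ∈ sep
  open FinSeparation public

  PointsTowards : FinSeparation → (List V → V → Set) → Set
  PointsTowards s f = ∀ w → f (sep s) w → B s w × ¬ A s w

  PointsAway : FinSeparation → (List V → V → Set) → Set
  PointsAway s f = ∀ w → f (sep s) w → A s w × ¬ B s w

  DominatesDir : V → (List V → V → Set) → Set₁
  DominatesDir v f = ∀ (s : FinSeparation) → PointsAway s f → A s v

  RevDominatesDir : V → (List V → V → Set) → Set₁
  RevDominatesDir v f = ∀ (s : FinSeparation) → PointsTowards s f → B s v

-- For a finite separation s with f_ω on the far side, call the other strict
-- side near: an edge from the near side leaves it only into sep s.  If v is
-- near and dominates ω through a fan to S ∈ ω, then, since fan paths share
-- only v, all but finitely many of them avoid sep s and end on a tail of S in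
-- C(sep s, ω); such a path would cross from near to far, which is impossible.
-- Conversely, if some finite X ∌ v admitted no walk from v to C(X, ω) in
-- D − X, the vertices so reachable together with X would form a separation
-- with f_ω far and v near.  So v reaches a fixed tail of a ray of ω avoiding
-- any finite X, and letting X be the inner vertices of the paths found so far
-- builds an infinite fan greedily.  Reverse domination is the same argument
-- with all edges read backwards.
module Submission where

open import Defs
open import Level using (Level)
open import Function using (_∘_)
open import Data.Nat using (ℕ; zero; suc; _+_; _≤_; _<_; z≤n; z<s; _≟_; _≤?_; _<?_)
open import Data.Nat.Properties
open import Data.Nat.Induction using (<-rec)
open import Data.Fin using (Fin; toℕ; fromℕ<; join; splitAt)
open import Data.Fin.Properties using (pigeonhole; toℕ-fromℕ<; splitAt-join)
open import Data.Product using (Σ; _×_; _,_; proj₁; proj₂)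
open import Data.Sum using (_⊎_; inj₁; inj₂; [_,_]′; map₁; fromInj₁; fromInj₂)
open import Data.Sum.Properties using (inj₁-injective; inj₂-injective)
open import Data.Empty using (⊥; ⊥-elim)
open import Data.List using (List; []; _++_; length; applyUpTo; lookup)
open import Data.List.Relation.Unary.Any using (index)
open import Data.List.Relation.Unary.Any.Properties using (lookup-index)
open import Data.List.Membership.Propositional using (_∈_; _∉_)
open import Data.List.Membership.Propositional.Properties
  using (∈-applyUpTo⁺; ∈-applyUpTo⁻; ∈-++⁺ˡ; ∈-++⁺ʳ; ∈-++⁻)
open import Function.Bundles using (_⇔_; mk⇔; Equivalence)
open import Relation.Nullary using (¬_; Dec; yes; no)
open import Relation.Nullary.Decidable using (toSum)
open import Relation.Binary.PropositionalEquality
open import Relation.Binary using (tri<; tri≈; tri>)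
open import Axiom.ExcludedMiddle using (ExcludedMiddle)

ℕ↣Fin⇒⊥ : ∀ {m} (f : ℕ → Fin m) → (∀ i j → f i ≡ f j → i ≡ j) → ⊥
ℕ↣Fin⇒⊥ {m} f f-injective
  with i , j , i<j , fi≡fj ← pigeonhole (n<1+n m) (f ∘ toℕ)
  = <⇒≢ i<j (f-injective (toℕ i) (toℕ j) fi≡fj)

module _ (lem : ∀ {ℓ} → ExcludedMiddle ℓ) where

  decide : (P : Set) → Dec P
  decide P = lem

  minimal : (P : ℕ → Set) → ∀ {n} → P n → Σ ℕ λ m → P m × (∀ k → k < m → ¬ P k)
  minimal P {n} = <-rec Minimal search n
    where
    Minimal : ℕ → Set
    Minimal n = P n → Σ ℕ λ m → P m × (∀ k → k < m → ¬ P k)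

    search : ∀ n → (∀ {k} → k < n → Minimal k) → Minimal n
    search n smaller Pn with decide (Σ ℕ λ k → k < n × P k)
    ... | yes (k , k<n , Pk) = smaller k<n Pk
    ... | no none = n , Pn , λ k k<n Pk → none (k , k<n , Pk)

  module _ (D : Digraph) where
    open Digraph D

    data Walk (o : Orientation D) (X : List V) (a : V) : V → Set where
      trivial : a ∉ X → Walk o X a a
      snoc    : ∀ {w u} → Walk o X a w → EdgeIn D o w u → u ∉ X → Walk o X a u

    walk-end∉ : ∀ {o X a w} → Walk o X a w → w ∉ X
    walk-end∉ (trivial a∉X)  = a∉X
    walk-end∉ (snoc _ _ u∉X) = u∉X

    reach-start∉ : ∀ {X u w} → Reach D X u w → u ∉ X
    reach-start∉ (here u∉X)     = u∉X
    reach-start∉ (step u∉X _ _) = u∉X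

    walk-extend : ∀ o {X a w t} → Walk o X a w → SameSC D X w t → Walk o X a t
    walk-extend forward  walk (w⇝t , _) = append walk w⇝t
      where
      append : ∀ {X a w t} → Walk forward X a w → Reach D X w t → Walk forward X a t
      append walk (here _)        = walk
      append walk (step _ e rest) = append (snoc walk e (reach-start∉ rest)) rest
    walk-extend backward walk (_ , t⇝w) = prepend t⇝w walk
      where
      prepend : ∀ {X a w t} → Reach D X t w → Walk backward X a w → Walk backward X a t
      prepend (here _)            walk = walk
      prepend (step t∉X e rest) walk = snoc (prepend rest walk) e t∉X

    AvoidingPath : Orientation D → List V → V → (V → Set) → Set
    AvoidingPath o X a B = Σ (PathAB D o a B) λ p → ∀ i → i ≤ len p → pt p i ∉ X

    truncate : ∀ {o X a B} (B′ : V → Set) → (p : AvoidingPath o X a B) →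
               let q = proj₁ p in
               ∀ i → i ≤ len q → B′ (pt q i) → (∀ k → k < i → ¬ B′ (pt q k)) →
               AvoidingPath o X a B′
    truncate B′ (q , q∉X) i i≤n hit before =
      record { len = i ; pt = pt q ; start = start q ; endB = hit ; avoid = before
             ; edges = λ k k<i → edges q k (<-≤-trans k<i i≤n)
             ; dist = λ j k j≤i k≤i → dist q j k (≤-trans j≤i i≤n) (≤-trans k≤i i≤n) }
      , λ k k≤i → q∉X k (≤-trans k≤i i≤n)

    extendAt : ℕ → V → (ℕ → V) → ℕ → V
    extendAt n u f i with i ≤? n
    ... | yes _ = f i
    ... | no _  = u

    extendAt-≤ : ∀ {n u f i} → i ≤ n → extendAt n u f i ≡ f i
    extendAt-≤ {n} {i = i} i≤n with i ≤? n
    ... | yes _  = refl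
    ... | no i≰n = ⊥-elim (i≰n i≤n)

    extendAt-new : ∀ {n u f} → extendAt n u f (suc n) ≡ u
    extendAt-new {n} with suc n ≤? n
    ... | yes 1+n≤n = ⊥-elim (1+n≰n 1+n≤n)
    ... | no _      = refl

    ≤-suc-cases : ∀ {i n} → i ≤ suc n → i ≤ n ⊎ i ≡ suc n
    ≤-suc-cases i≤1+n = map₁ ≤-pred (m≤n⇒m<n∨m≡n i≤1+n)

    appendVertex : ∀ {o X a w u} (p : AvoidingPath o X a (_≡ w)) → EdgeIn D o w u → u ∉ X →
                   (∀ i → i ≤ len (proj₁ p) → pt (proj₁ p) i ≢ u) → AvoidingPath o X a (_≡ u)
    appendVertex {o} {X} {u = u} (p , p∉X) e u∉X fresh =
      record { len = suc n ; pt = q ; start = trans (old z≤n) (start p) ; endB = new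
             ; avoid = λ i i<1+n → q≢u i (≤-pred i<1+n) ; edges = edges′ ; dist = dist′ }
      , q∉X
      where
      n = len p
      q = extendAt n u (pt p)

      old : ∀ {i} → i ≤ n → q i ≡ pt p i
      old = extendAt-≤

      new : q (suc n) ≡ u
      new = extendAt-new {n} {u} {pt p}

      q≢u : ∀ i → i ≤ n → q i ≢ u
      q≢u i i≤n = subst (_≢ u) (sym (old i≤n)) (fresh i i≤n)

      edges′ : ∀ i → i < suc n → EdgeIn D o (q i) (q (suc i))
      edges′ i i<1+n with m≤n⇒m<n∨m≡n (≤-pred i<1+n)
      ... | inj₁ i<n  = subst₂ (EdgeIn D o) (sym (old (<⇒≤ i<n))) (sym (old i<n)) (edges p i i<n)
      ... | inj₂ refl = subst₂ (EdgeIn D o) (sym (trans (old ≤-refl) (endB p))) (sym new) e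

      dist′ : ∀ i j → i ≤ suc n → j ≤ suc n → q i ≡ q j → i ≡ j
      dist′ i j i≤ j≤ eq with ≤-suc-cases i≤ | ≤-suc-cases j≤
      ... | inj₁ i≤n  | inj₁ j≤n  = dist p i j i≤n j≤n (trans (sym (old i≤n)) (trans eq (old j≤n)))
      ... | inj₁ i≤n  | inj₂ refl = ⊥-elim (q≢u i i≤n (trans eq new))
      ... | inj₂ refl | inj₁ j≤n  = ⊥-elim (q≢u j j≤n (trans (sym eq) new))
      ... | inj₂ refl | inj₂ refl = refl

      q∉X : ∀ i → i ≤ suc n → q i ∉ X
      q∉X i i≤ with ≤-suc-cases i≤
      ... | inj₁ i≤n  = subst (_∉ X) (sym (old i≤n)) (p∉X i i≤n)
      ... | inj₂ refl = subst (_∉ X) (sym new) u∉X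

    loopErase : ∀ {o X a w} → Walk o X a w → AvoidingPath o X a (_≡ w)
    loopErase {a = a} (trivial a∉X) =
      record { len = 0 ; pt = λ _ → a ; start = refl ; endB = refl ; avoid = λ _ ()
             ; edges = λ _ () ; dist = λ { _ _ z≤n z≤n _ → refl } }
      , λ _ _ → a∉X
    loopErase (snoc {u = u} walk e u∉X)
      with p ← loopErase walk | decide (Σ ℕ λ i → i ≤ len (proj₁ p) × pt (proj₁ p) i ≡ u)
    ... | yes (i , i≤n , hit) = truncate (_≡ u) p i i≤n hit λ k k<i eq →
            <⇒≢ k<i (dist (proj₁ p) k i (≤-trans (<⇒≤ k<i) i≤n) i≤n (trans eq (sym hit)))
    ... | no fresh = appendVertex p e u∉X λ i i≤n eq → fresh (i , i≤n , eq)

    walk⇒path : ∀ {o X a w} {T : V → Set} → Walk o X a w → T w → AvoidingPath o X a T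
    walk⇒path {T = T} walk Tw
      with p ← loopErase walk
      with m , (m≤n , Tm) , earlier ← minimal (λ i → i ≤ len (proj₁ p) × T (pt (proj₁ p) i))
                                              (≤-refl , subst T (sym (endB (proj₁ p))) Tw)
      = truncate T p m m≤n Tm λ k k<m Tk → earlier k k<m (≤-trans (<⇒≤ k<m) m≤n , Tk)

    interior : ∀ {o a B} → PathAB D o a B → List V
    interior p = applyUpTo (pt p ∘ suc) (len p)

    ∈-interior : ∀ {o a B} (p : PathAB D o a B) {i} → 0 < i → i ≤ len p → pt p i ∈ interior p
    ∈-interior p {suc i} _ i<n = ∈-applyUpTo⁺ (pt p ∘ suc) i<n

    start∉interior : ∀ {o a B} (p : PathAB D o a B) → a ∉ interior p
    start∉interior p a∈ with i , i<n , eq ← ∈-applyUpTo⁻ (pt p ∘ suc) a∈ =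
      0≢1+n (dist p 0 (suc i) z≤n i<n (trans (start p) eq))

    greedyFan : ∀ {o a T} → ¬ T a → (∀ X → a ∉ X → AvoidingPath o X a T) → InfiniteFan D o a T
    greedyFan {o} {a} {T} ¬Ta paths = record { path = path ; meet = meet ; distinct = distinct }
      where
      mutual
        used : ℕ → List V
        used zero    = []
        used (suc k) = interior (path k) ++ used k

        a∉used : ∀ k → a ∉ used k
        a∉used zero    ()
        a∉used (suc k) a∈ = [ start∉interior (path k) , a∉used k ]′ (∈-++⁻ (interior (path k)) a∈)

        next : ∀ k → AvoidingPath o (used k) a T
        next k = paths (used k) (a∉used k)

        path : ℕ → PathAB D o a T
        path k = proj₁ (next k)

      used-grows : ∀ {j k} → j < k → ∀ {i} → 0 < i → i ≤ len (path j) → pt (path j) i ∈ used k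
      used-grows {j} {suc k} j<1+k 0<i i≤n with m≤n⇒m<n∨m≡n (≤-pred j<1+k)
      ... | inj₁ j<k  = ∈-++⁺ʳ (interior (path k)) (used-grows j<k 0<i i≤n)
      ... | inj₂ refl = ∈-++⁺ˡ (∈-interior (path j) 0<i i≤n)

      meet : ∀ j k → j ≢ k → ∀ i l → i ≤ len (path j) → l ≤ len (path k) →
             pt (path j) i ≡ pt (path k) l → pt (path j) i ≡ a
      meet j k _ zero l _ _ _ = start (path j)
      meet j k _ (suc i) zero _ _ eq = trans eq (start (path k))
      meet j k j≢k (suc i) (suc l) i≤ l≤ eq with <-cmp j k
      ... | tri< j<k _ _ = ⊥-elim (proj₂ (next k) (suc l) l≤ (subst (_∈ used k) eq (used-grows j<k z<s i≤)))
      ... | tri≈ _ j≡k _ = ⊥-elim (j≢k j≡k)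
      ... | tri> _ _ k<j = ⊥-elim (proj₂ (next j) (suc i) i≤ (subst (_∈ used j) (sym eq) (used-grows k<j z<s l≤)))

      distinct : ∀ j k → j ≢ k → pt (path j) (len (path j)) ≢ pt (path k) (len (path k))
      distinct j k j≢k eq = ¬Ta (subst T (meet j k j≢k _ _ ≤-refl ≤-refl eq) (endB (path j)))

    module _ {o a} (S : Ray D) (F : InfiniteFan D o a (OnRay D S)) where
      open InfiniteFan F

      endIndex : ℕ → ℕ
      endIndex j = proj₁ (endB (path j))

      endIndex-injective : ∀ j k → endIndex j ≡ endIndex k → j ≡ k
      endIndex-injective j k eq with j ≟ k
      ... | yes j≡k = j≡k
      ... | no j≢k  = ⊥-elim (distinct j k j≢k
              (trans (sym (proj₂ (endB (path j)))) (trans (cong (vtx S) eq) (proj₂ (endB (path k))))))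

      Hits : List V → ℕ → Set
      Hits X j = Σ ℕ λ i → i ≤ len (path j) × pt (path j) i ∈ X

      -- Codes are injective: fan paths have distinct ends and share only a ∉ X.
      finitelyManyBlocked : ∀ {X} → a ∉ X → ∀ n → ¬ (∀ j → endIndex j < n ⊎ Hits X j)
      finitelyManyBlocked {X} a∉X n blocked = ℕ↣Fin⇒⊥ (λ j → join n (length X) (code j (blocked j))) injective
        where
        code : ∀ j → endIndex j < n ⊎ Hits X j → Fin n ⊎ Fin (length X)
        code j (inj₁ e<n)            = inj₁ (fromℕ< e<n)
        code j (inj₂ (_ , _ , x∈X)) = inj₂ (index x∈X)

        code-injective : ∀ j k b c → code j b ≡ code k c → j ≡ k
        code-injective j k (inj₁ e<n) (inj₁ e′<n) eq = endIndex-injective j k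
          (trans (sym (toℕ-fromℕ< e<n)) (trans (cong toℕ (inj₁-injective eq)) (toℕ-fromℕ< e′<n)))
        code-injective j k (inj₂ (i , i≤ , x∈X)) (inj₂ (l , l≤ , y∈X)) eq with j ≟ k
        ... | yes j≡k = j≡k
        ... | no j≢k  = ⊥-elim (a∉X (subst (_∈ X) (meet j k j≢k i l i≤ l≤ same) x∈X))
          where
          same : pt (path j) i ≡ pt (path k) l
          same = trans (lookup-index x∈X) (trans (cong (lookup X) (inj₂-injective eq)) (sym (lookup-index y∈X)))
        code-injective _ _ (inj₁ _) (inj₂ _) ()
        code-injective _ _ (inj₂ _) (inj₁ _) ()

        injective : ∀ j k → join n (length X) (code j (blocked j)) ≡ join n (length X) (code k (blocked k)) → j ≡ k
        injective j k eq = code-injective j k (blocked j) (blocked k)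
          (trans (sym (splitAt-join n (length X) _)) (trans (cong (splitAt n) eq) (splitAt-join n (length X) _)))

      fanPathAvoiding : ∀ {X} → a ∉ X → ∀ n →
                        Σ ℕ λ j → n ≤ endIndex j × (∀ i → i ≤ len (path j) → pt (path j) i ∉ X)
      fanPathAvoiding {X} a∉X n with decide (Σ ℕ λ j → n ≤ endIndex j × ¬ Hits X j)
      ... | yes (j , n≤e , misses) = j , n≤e , λ i i≤ x∈X → misses (i , i≤ , x∈X)
      ... | no none = ⊥-elim (finitelyManyBlocked a∉X n blocked)
        where
        blocked : ∀ j → endIndex j < n ⊎ Hits X j
        blocked j with endIndex j <? n | decide (Hits X j)
        ... | yes e<n | _         = inj₁ e<n
        ... | no _    | yes hits  = inj₂ hits
        ... | no e≮n  | no misses = ⊥-elim (none (j , ≮⇒≥ e≮n , misses))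

    C-avoids : ∀ {X} ω {w} → C D X ω w → w ∉ X
    C-avoids _ (n , sameSC) = reach-start∉ (proj₁ (sameSC n ≤-refl))

    fan⇒pathToC : ∀ {o a} S ω {X} → InfiniteFan D o a (OnRay D S) → InEnd D S ω → a ∉ X →
                  Σ (AvoidingPath o X a (OnRay D S)) λ p → C D X ω (pt (proj₁ p) (len (proj₁ p)))
    fan⇒pathToC S ω {X} F (_ , S≈ω) a∉X
      with n₀ , close ← S≈ω X
      with j , n₀≤e , p∉X ← fanPathAvoiding S F a∉X n₀
      = (p , p∉X) , n₀ , λ i n₀≤i →
          subst (λ x → SameSC D X x (vtx (rep ω) i)) (proj₂ (endB p)) (close (endIndex S F j) i n₀≤e n₀≤i)
      where p = InfiniteFan.path F j

    tail : Ray D → ℕ → Ray D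
    tail R m = record
      { vtx  = λ i → vtx R (m + i)
      ; inj  = λ i j eq → +-cancelˡ-≡ m i j (inj R (m + i) (m + j) eq)
      ; edge = λ i → subst (λ k → E (vtx R (m + i)) (vtx R k)) (sym (+-suc m i)) (edge R (m + i)) }

    rep-InEnd : ∀ ω → InEnd D (rep ω) ω
    rep-InEnd ω = solid ω , solid ω

    tail-InEnd : ∀ S ω m → InEnd D S ω → InEnd D (tail S m) ω
    tail-InEnd _ _ m (S-solid , S≈ω) =
        (λ X → let n , same = S-solid X in n , λ i j n≤i n≤j → same (m + i) (m + j) (shift n≤i) (shift n≤j))
      , (λ X → let n , same = S≈ω X in n , λ i j n≤i n≤j → same (m + i) j (shift n≤i) n≤j)
      where
      shift : ∀ {n i} → n ≤ i → n ≤ m + i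
      shift n≤i = ≤-trans n≤i (m≤n+m _ m)

    tail-avoiding : ∀ R v → Σ ℕ λ m → ¬ OnRay D (tail R m) v
    tail-avoiding R v with decide (OnRay D R v)
    ... | yes (i , Ri≡v) = suc i , λ (k , eq) → m≢1+m+n i (sym (inj R (suc i + k) i (trans eq (sym Ri≡v))))
    ... | no off         = 0 , off

    -- An o-path on the near side of s stays there until it meets sep s (near-step);
    -- s points away from f (o = forward) resp. towards f (o = backward) iff f is far.
    Near Far : Orientation D → FinSeparation D → V → Set
    Near forward  s w = B s w × ¬ A s w
    Near backward s w = A s w × ¬ B s w
    Far  forward  s w = A s w × ¬ B s w
    Far  backward s w = B s w × ¬ A s w

    PointsFar : Orientation D → FinSeparation D → (List V → V → Set) → Set
    PointsFar o s f = ∀ w → f (sep s) w → Far o s w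

    near-far-disjoint : ∀ o {s w} → Near o s w → Far o s w → ⊥
    near-far-disjoint forward  (_ , ¬A) (A , _) = ¬A A
    near-far-disjoint backward (_ , ¬B) (B , _) = ¬B B

    near⇒∉sep : ∀ o {s w} → Near o s w → w ∉ sep s
    near⇒∉sep forward  {s} {w} (_ , ¬A) w∈ = ¬A (proj₁ (Equivalence.from (sepOK s w) w∈))
    near⇒∉sep backward {s} {w} (_ , ¬B) w∈ = ¬B (proj₂ (Equivalence.from (sepOK s w) w∈))

    near-step : ∀ o s {u w} → Near o s u → EdgeIn D o u w → w ∉ sep s → Near o s w
    near-step forward s {u} {w} (Bu , ¬Au) e w∉ = fromInj₂ (⊥-elim ∘ ¬Aw) (cover s w) , ¬Aw
      where
      ¬Aw : ¬ A s w
      ¬Aw Aw = noBA s u w e Bu ¬Au Aw λ Bw → w∉ (Equivalence.to (sepOK s w) (Aw , Bw))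
    near-step backward s {u} {w} (Au , ¬Bu) e w∉ = fromInj₁ (⊥-elim ∘ ¬Bw) (cover s w) , ¬Bw
      where
      ¬Bw : ¬ B s w
      ¬Bw Bw = noBA s w u e Bw (λ Aw → w∉ (Equivalence.to (sepOK s w) (Aw , Bw))) Au ¬Bu

    near-along : ∀ {o a T} s (p : PathAB D o a T) → (∀ i → i ≤ len p → pt p i ∉ sep s) →
                 Near o s a → ∀ i → i ≤ len p → Near o s (pt p i)
    near-along s p p∉ near zero    _   = subst (Near _ s) (sym (start p)) near
    near-along s p p∉ near (suc i) i<n =
      near-step _ s (near-along s p p∉ near i (<⇒≤ i<n)) (edges p i i<n) (p∉ (suc i) i<n)

    Closed : Orientation D → List V → (V → Set) → Set
    Closed o X Z = ∀ {u w} → Z u → EdgeIn D o u w → w ∉ X → Z w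

    closedSeparation : ∀ o X (Z : V → Set) → Closed o X Z → (∀ {w} → Z w → w ∉ X) → FinSeparation D
    closedSeparation forward X Z closed Z∉X = record
      { A     = λ w → ¬ Z w
      ; B     = λ w → Z w ⊎ w ∈ X
      ; cover = λ w → [ inj₂ ∘ inj₁ , inj₁ ]′ (toSum (decide (Z w)))
      ; noBA  = λ u w e _ ¬¬Zu ¬Zw ¬Bw → ¬¬Zu λ Zu → ¬Zw (closed Zu e (¬Bw ∘ inj₂))
      ; sep   = X
      ; sepOK = λ w → mk⇔ (λ { (¬Zw , inj₁ Zw) → ⊥-elim (¬Zw Zw) ; (_ , inj₂ w∈X) → w∈X })
                          (λ w∈X → (λ Zw → Z∉X Zw w∈X) , inj₂ w∈X) }
    closedSeparation backward X Z closed Z∉X = record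
      { A     = λ w → Z w ⊎ w ∈ X
      ; B     = λ w → ¬ Z w
      ; cover = λ w → [ inj₁ ∘ inj₁ , inj₂ ]′ (toSum (decide (Z w)))
      ; noBA  = λ u w e ¬Zu ¬Au _ ¬¬Zw → ¬¬Zw λ Zw → ¬Zu (closed Zw e (¬Au ∘ inj₂))
      ; sep   = X
      ; sepOK = λ w → mk⇔ (λ { (inj₁ Zw , ¬Zw) → ⊥-elim (¬Zw Zw) ; (inj₂ w∈X , _) → w∈X })
                          (λ w∈X → inj₂ w∈X , λ Zw → Z∉X Zw w∈X) }

    near-closedSeparation : ∀ o X (Z : V → Set) (closed : Closed o X Z) (Z∉X : ∀ {w} → Z w → w ∉ X) →
                            ∀ {w} → Z w → Near o (closedSeparation o X Z closed Z∉X) w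
    near-closedSeparation forward  _ _ _ _ Zw = inj₁ Zw , λ ¬Zw → ¬Zw Zw
    near-closedSeparation backward _ _ _ _ Zw = inj₁ Zw , λ ¬Zw → ¬Zw Zw

    closedSeparation-pointsFar : ∀ o X (Z : V → Set) (closed : Closed o X Z) (Z∉X : ∀ {w} → Z w → w ∉ X) →
                                 ∀ {f : List V → V → Set} → (∀ {w} → f X w → ¬ Z w) → (∀ {w} → f X w → w ∉ X) →
                                 PointsFar o (closedSeparation o X Z closed Z∉X) f
    closedSeparation-pointsFar forward  _ _ _ _ f∩Z=∅ f∩X=∅ w fw = f∩Z=∅ fw , [ f∩Z=∅ fw , f∩X=∅ fw ]′
    closedSeparation-pointsFar backward _ _ _ _ f∩Z=∅ f∩X=∅ w fw = f∩Z=∅ fw , [ f∩Z=∅ fw , f∩X=∅ fw ]′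

    -- For o = forward / backward this unfolds to DominatesEnd / RevDominatesEnd.
    DominatesEndIn : Orientation D → V → End D → Set
    DominatesEndIn o v ω = Σ (Ray D) λ S → InEnd D S ω × InfiniteFan D o v (OnRay D S)

    DominatesDirIn : Orientation D → V → (List V → V → Set) → Set₁
    DominatesDirIn forward  = DominatesDir D
    DominatesDirIn backward = RevDominatesDir D

    dominatesDir-elim : ∀ o {v f} → DominatesDirIn o v f → ∀ s → PointsFar o s f → ¬ Near o s v
    dominatesDir-elim forward  dom s far (_ , ¬A) = ¬A (dom s far)
    dominatesDir-elim backward dom s far (_ , ¬B) = ¬B (dom s far)

    dominatesDir-intro : ∀ o {v f} → (∀ s → PointsFar o s f → ¬ Near o s v) → DominatesDirIn o v f
    dominatesDir-intro forward {v} safe s far with decide (A s v)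
    ... | yes Av = Av
    ... | no ¬Av = ⊥-elim (safe s far (fromInj₂ (⊥-elim ∘ ¬Av) (cover s v) , ¬Av))
    dominatesDir-intro backward {v} safe s far with decide (B s v)
    ... | yes Bv = Bv
    ... | no ¬Bv = ⊥-elim (safe s far (fromInj₁ (⊥-elim ∘ ¬Bv) (cover s v) , ¬Bv))

    dominatesEnd⇒dominatesDir : ∀ o ω v → DominatesEndIn o v ω → DominatesDirIn o v (f[_] D ω)
    dominatesEnd⇒dominatesDir o ω v (S , S∈ω , F) = dominatesDir-intro o λ s far near-v →
      let ((p , p∉sep) , end∈C) = fan⇒pathToC S ω F S∈ω (near⇒∉sep o near-v)
      in near-far-disjoint o (near-along s p p∉sep near-v (len p) ≤-refl) (far _ end∈C)

    dominatesDir⇒walkToC : ∀ o ω v {X} → DominatesDirIn o v (f[_] D ω) → v ∉ X →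
                           Σ V λ w → Walk o X v w × C D X ω w
    dominatesDir⇒walkToC o ω v {X} dom v∉X with decide (Σ V λ w → Walk o X v w × C D X ω w)
    ... | yes reached = reached
    ... | no unreached = ⊥-elim (dominatesDir-elim o dom s far
                                   (near-closedSeparation o X (Walk o X v) snoc walk-end∉ (trivial v∉X)))
      where
      s = closedSeparation o X (Walk o X v) snoc walk-end∉

      far : PointsFar o s (f[_] D ω)
      far = closedSeparation-pointsFar o X (Walk o X v) snoc walk-end∉ {f[_] D ω}
              (λ {w} w∈C walk → unreached (w , walk , w∈C)) (C-avoids ω)

    dominatesDir⇒dominatesEnd : ∀ o ω v → DominatesDirIn o v (f[_] D ω) → DominatesEndIn o v ω
    dominatesDir⇒dominatesEnd o ω v dom = R′ , tail-InEnd (rep ω) ω m (rep-InEnd ω) , greedyFan v∉R′ paths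
      where
      m = proj₁ (tail-avoiding (rep ω) v)
      v∉R′ = proj₂ (tail-avoiding (rep ω) v)
      R′ = tail (rep ω) m

      paths : ∀ X → v ∉ X → AvoidingPath o X v (OnRay D R′)
      paths X v∉X with w , walk , n , sameSC ← dominatesDir⇒walkToC o ω v dom v∉X =
        walk⇒path (walk-extend o walk (sameSC (m + n) (m≤n+m n m))) (n , refl)

    dominatesEnd⇔dominatesDir : ∀ o ω v → DominatesEndIn o v ω ⇔ DominatesDirIn o v (f[_] D ω)
    dominatesEnd⇔dominatesDir o ω v = mk⇔ (dominatesEnd⇒dominatesDir o ω v) (dominatesDir⇒dominatesEnd o ω v)

proposition4p4 : (lem : ∀ {ℓ : Level} → ExcludedMiddle ℓ) →
    (D : Digraph) (ω : End D) (v : Digraph.V D) →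
      (DominatesEnd D v ω ⇔ DominatesDir D v (f[_] D ω))
      × (RevDominatesEnd D v ω ⇔ RevDominatesDir D v (f[_] D ω))
proposition4p4 lem D ω v =
  dominatesEnd⇔dominatesDir lem D forward ω v , dominatesEnd⇔dominatesDir lem D backward ω v
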